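{- Let $\mathcal{S}$ be a scramble on a finite connected graph $G$. Then $e(\mathcal{S})$ equals the minimum of $|E(A,A^C)|$ taken over all egg-cuts $A$ of $\mathcal{S}$ such that both $A$ and $A^C$ are connected (this minimum being $\infty$ if there are no egg-cuts).
   Context: Graphs are finite, connected, undirected multigraphs without loops. For $A,B\subseteq V(G)$, $E(A,B)$ is the multiset of edges with one endpoint in $A$ and the other in $B$; $A^C=V(G)\setminus A$. A set $S\subseteq V(G)$ is connected if the induced subgraph $G[S]$ is connected. A scramble on $G$ is a collection $\mathcal{S}$ of nonempty connected subsets of $V(G)$ (eggs). An egg-cut is a set $A\subseteq V(G)$ such that both $A$ and $A^C$ contain an egg; its size is $|E(A,A^C)|$; $e(\mathcal{S})$ is the minimum size of an egg-cut ($\infty$ if none exists). -}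

module Defs where

open import Data.Nat using (ℕ; _≤_)
open import Data.Fin using (Fin)
open import Data.Fin.Subset using (Subset; _∈_; ∁; Nonempty; ⊤)
open import Data.Bool using (Bool; _xor_)
open import Data.Vec using (lookup)
open import Data.List using (List; length; filterᵇ)
open import Data.List.Membership.Propositional using () renaming (_∈_ to _∈ₗ_)
open import Data.List.Relation.Unary.All using (All)
open import Data.Maybe using (Maybe; just; nothing)
open import Data.Product using (_×_; _,_; Σ; ∃; proj₁; proj₂)
open import Data.Sum using (_⊎_)
open import Relation.Binary.PropositionalEquality using (_≡_; _≢_)
open import Relation.Nullary using (¬_)

-- A finite undirected multigraph on vertex set Fin n, given as a list of
-- edges (a multiset; each pair (u , v) is an undirected edge u—v).
record RawGraph : Set where
  field
    n     : ℕ
    edges : List (Fin n × Fin n)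
open RawGraph public

Adj : (G : RawGraph) → Fin (n G) → Fin (n G) → Set
Adj G u v = ((u , v) ∈ₗ edges G) ⊎ ((v , u) ∈ₗ edges G)

data Reach (G : RawGraph) (S : Subset (n G)) : Fin (n G) → Fin (n G) → Set where
  here : ∀ {u} → u ∈ S → Reach G S u u
  step : ∀ {u v w} → u ∈ S → Adj G u v → Reach G S v w → Reach G S u w

IsConnected : (G : RawGraph) → Subset (n G) → Set
IsConnected G S = ∀ u v → u ∈ S → v ∈ S → Reach G S u v

record Graph : Set where
  field
    raw       : RawGraph
    noLoops   : All (λ e → proj₁ e ≢ proj₂ e) (edges raw)
    connected : IsConnected raw ⊤
open Graph public

record Scramble (G : Graph) : Set where
  field
    eggs          : List (Subset (n (raw G)))
    eggsNonempty  : All Nonempty eggs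
    eggsConnected : All (IsConnected (raw G)) eggs
open Scramble public

_⊆ₛ_ : ∀ {m} → Subset m → Subset m → Set
E ⊆ₛ A = ∀ x → x ∈ E → x ∈ A

ContainsEgg : ∀ {G} → Scramble G → Subset (n (raw G)) → Set
ContainsEgg 𝒮 A = Σ _ λ E → (E ∈ₗ eggs 𝒮) × (E ⊆ₛ A)

EggCut : ∀ {G} → Scramble G → Subset (n (raw G)) → Set
EggCut 𝒮 A = ContainsEgg 𝒮 A × ContainsEgg 𝒮 (∁ A)

cutSize : (G : Graph) → Subset (n (raw G)) → ℕ
cutSize G A = length (filterᵇ (λ e → lookup A (proj₁ e) xor lookup A (proj₂ e)) (edges (raw G)))

-- ℕ ∪ {∞}, with nothing = ∞
ℕ∞ : Set
ℕ∞ = Maybe ℕ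

IsMinOver : ∀ {m} → (Subset m → Set) → (Subset m → ℕ) → ℕ∞ → Set
IsMinOver P f nothing  = ∀ A → ¬ P A
IsMinOver P f (just k) = (∃ λ A → P A × f A ≡ k) × (∀ A → P A → k ≤ f A)

EggCutNumber : (G : Graph) → Scramble G → ℕ∞ → Set
EggCutNumber G 𝒮 v = IsMinOver (EggCut 𝒮) (cutSize G) v

ConnectedEggCut : (G : Graph) → Scramble G → Subset (n (raw G)) → Set
ConnectedEggCut G 𝒮 A = EggCut 𝒮 A × IsConnected (raw G) A × IsConnected (raw G) (∁ A)

-- Take a minimum egg-cut A with eggs E₁ ⊆ A and E₂ ⊆ Aᶜ. Let C be the component of G[A]
-- containing E₁ and D the component of G[Cᶜ] containing E₂. Both are closed under
-- adjacency inside the set they were cut from, so passing to them never adds crossing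
-- edges: |E(D,Dᶜ)| ≤ |E(Cᶜ,C)| ≤ |E(A,Aᶜ)|. D is connected by construction, and Dᶜ is
-- connected because every vertex outside D walks to the connected set C without
-- entering D. Thus D is a connected egg-cut of minimum size.
module Submission where

open import Defs
open import Data.Maybe using (just; nothing)
open import Data.Nat using (suc; _≤_; _<_; s≤s)
open import Data.Nat.Properties using (module ≤-Reasoning; ≤-refl; ≤-trans; ≤-antisym; ≤-reflexive; <-≤-trans; ≤-pred; m≤n⇒m≤1+n)
open import Data.Bool using (true; false; not; _xor_; T)
open import Data.Bool.Properties using (T-≡; xor-annihilates-not)
open import Data.Fin using (Fin; _≟_)
open import Data.Fin.Subset using (Subset; _∈_; _∉_; _⊆_; ∁; ⊤; ∣_∣; _-_; _─_; ⁅_⁆; Nonempty; inside; outside)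
open import Data.Fin.Subset.Properties
  using (_∈?_; x∈p∧x≢y⇒x∈p-y; p─q⊆p; x∈p⇒∣p-x∣<∣p∣; x∈⁅x⁆; ∈⊤; x∈∁p⇒x∉p; x∉p⇒x∈∁p; x∈p⇒x∉∁p; p⊆q⇒∁p⊇∁q)
open import Data.Fin.Properties using (any?)
open import Data.Vec using (lookup; tabulate; _∷_)
open import Data.Vec.Properties using (lookup∘tabulate; []=⇒lookup; lookup⇒[]=; lookup-map)
import Data.Vec.Base as Vec
open import Data.List using (List; length; filter; _∷_; [])
open import Data.List.Properties using (filter-≐)
open import Data.List.Membership.Propositional using () renaming (_∈_ to _∈ₗ_)
import Data.List.Membership.DecPropositional as DecMembership
import Data.List.Relation.Unary.Any as Any
import Data.List.Relation.Unary.All as All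
open import Data.Product using (_×_; _,_; ∃; proj₁; proj₂)
open import Data.Product.Properties using (≡-dec)
open import Data.Sum using (_⊎_; inj₁; inj₂)
open import Function using (_∘_; Equivalence)
open import Relation.Binary.PropositionalEquality using (_≡_; _≢_; refl; sym; trans; subst; cong; cong₂)
open import Relation.Nullary using (Dec; yes; no; contradiction)
open import Relation.Nullary.Decidable using (isYes; fromWitness; toWitness; _×-dec_; _⊎-dec_)
open import Relation.Unary using (Pred; Decidable)

length-filter-mono : ∀ {a p q} {A : Set a} {P : Pred A p} {Q : Pred A q}
  (P? : Decidable P) (Q? : Decidable Q) (xs : List A) →
  (∀ {x} → x ∈ₗ xs → P x → Q x) → length (filter P? xs) ≤ length (filter Q? xs)
length-filter-mono P? Q? [] P⇒Q = ≤-refl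
length-filter-mono P? Q? (x ∷ xs) P⇒Q with P? x | Q? x
... | yes Px | yes _  = s≤s (length-filter-mono P? Q? xs (P⇒Q ∘ Any.there))
... | yes Px | no ¬Qx = contradiction (P⇒Q (Any.here refl) Px) ¬Qx
... | no _   | yes _  = m≤n⇒m≤1+n (length-filter-mono P? Q? xs (P⇒Q ∘ Any.there))
... | no _   | no _   = length-filter-mono P? Q? xs (P⇒Q ∘ Any.there)

x∈p─q⇒x∉q : ∀ {m} {p q : Subset m} {x} → x ∈ p ─ q → x ∉ q
x∈p─q⇒x∉q {p = _ ∷ _} {inside  ∷ _} ()            Vec.here
x∈p─q⇒x∉q {p = _ ∷ _} {outside ∷ _} Vec.here      ()
x∈p─q⇒x∉q {p = _ ∷ _} {_       ∷ _} (Vec.there x∈) (Vec.there x∈q) = x∈p─q⇒x∉q x∈ x∈q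

x∉p-x : ∀ {m} {p : Subset m} x → x ∉ p - x
x∉p-x x x∈ = x∈p─q⇒x∉q x∈ (x∈⁅x⁆ x)

⊆∁⇒⊆∁ : ∀ {m} {p q : Subset m} → p ⊆ ∁ q → q ⊆ ∁ p
⊆∁⇒⊆∁ p⊆∁q x∈q = x∉p⇒x∈∁p (x∈p⇒x∉∁p x∈q ∘ p⊆∁q)

module _ {R : RawGraph} where

  private
    V = Fin (n R)

  Adj-sym : ∀ {u v} → Adj R u v → Adj R v u
  Adj-sym (inj₁ uv) = inj₂ uv
  Adj-sym (inj₂ vu) = inj₁ vu

  Adj? : ∀ u v → Dec (Adj R u v)
  Adj? u v = ((u , v) ∈ₗ? edges R) ⊎-dec ((v , u) ∈ₗ? edges R)
    where open DecMembership (≡-dec _≟_ _≟_) using () renaming (_∈?_ to _∈ₗ?_)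

  Reach-source : ∀ {S u v} → Reach R S u v → u ∈ S
  Reach-source (here u∈) = u∈
  Reach-source (step u∈ _ _) = u∈

  Reach-target : ∀ {S u v} → Reach R S u v → v ∈ S
  Reach-target (here v∈) = v∈
  Reach-target (step _ _ r) = Reach-target r

  Reach-mono : ∀ {S T u v} → S ⊆ T → Reach R S u v → Reach R T u v
  Reach-mono S⊆T (here u∈) = here (S⊆T u∈)
  Reach-mono S⊆T (step u∈ a r) = step (S⊆T u∈) a (Reach-mono S⊆T r)

  Reach-trans : ∀ {S u v w} → Reach R S u v → Reach R S v w → Reach R S u w
  Reach-trans (here _) r′ = r′
  Reach-trans (step u∈ a r) r′ = step u∈ a (Reach-trans r r′)

  Reach-snoc : ∀ {S u v w} → Reach R S u v → Adj R v w → w ∈ S → Reach R S u w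
  Reach-snoc r a w∈ = Reach-trans r (step (Reach-target r) a (here w∈))

  Reach-sym : ∀ {S u v} → Reach R S u v → Reach R S v u
  Reach-sym (here u∈) = here u∈
  Reach-sym (step u∈ a r) = Reach-snoc (Reach-sym r) (Adj-sym a) u∈

  Reach-after-last-visit : ∀ {S x v} u → Reach R S x v →
    Reach R (S - u) x v ⊎ u ≡ v ⊎ ∃ λ w → Adj R u w × Reach R (S - u) w v
  Reach-after-last-visit u (here {x} x∈) with x ≟ u
  ... | yes refl = inj₂ (inj₁ refl)
  ... | no x≢u   = inj₁ (here (x∈p∧x≢y⇒x∈p-y x∈ x≢u))
  Reach-after-last-visit u (step {x} {y} x∈ a r) with Reach-after-last-visit u r
  ... | inj₂ later = inj₂ later
  ... | inj₁ r′ with x ≟ u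
  ...   | yes refl = inj₂ (inj₂ (y , a , r′))
  ...   | no x≢u   = inj₁ (step (x∈p∧x≢y⇒x∈p-y x∈ x≢u) a r′)

  Reach-leave : ∀ {S u v} → Reach R S u v → u ≢ v →
    ∃ λ w → Adj R u w × Reach R (S - u) w v
  Reach-leave {u = u} r u≢v with Reach-after-last-visit u r
  ... | inj₁ r′               = contradiction (Reach-source r′) (x∉p-x u)
  ... | inj₂ (inj₁ u≡v)       = contradiction u≡v u≢v
  ... | inj₂ (inj₂ departure) = departure

  -- By Reach-leave a walk from u to v ≢ u may avoid u after its first step, so the search
  -- recurses on the strictly smaller S - u.
  Reach?-bounded : ∀ k S → ∣ S ∣ < k → ∀ u v → Dec (Reach R S u v)
  Reach?-bounded (suc k) S ∣S∣<k u v with u ∈? S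
  ... | no u∉ = no (u∉ ∘ Reach-source)
  ... | yes u∈ with u ≟ v
  ...   | yes refl = yes (here u∈)
  ...   | no u≢v with any? (λ w → Adj? u w ×-dec Reach?-bounded k (S - u) ∣S-u∣<k w v)
    where ∣S-u∣<k = <-≤-trans (x∈p⇒∣p-x∣<∣p∣ u∈) (≤-pred ∣S∣<k)
  ...     | yes (w , a , r) = yes (step u∈ a (Reach-mono (p─q⊆p S ⁅ u ⁆) r))
  ...     | no ¬departure   = no (¬departure ∘ λ r → Reach-leave r u≢v)

  Reach? : ∀ S u v → Dec (Reach R S u v)
  Reach? S = Reach?-bounded (suc ∣ S ∣) S ≤-refl

  ClosedIn : Subset (n R) → Subset (n R) → Set
  ClosedIn C S = ∀ {x y} → x ∈ C → Adj R x y → y ∈ S → y ∈ C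

  Reach-closed : ∀ {C S x y} → ClosedIn C S → Reach R S x y → x ∈ C → Reach R C x y
  Reach-closed closed (here _) x∈C = here x∈C
  Reach-closed closed (step _ a r) x∈C =
    step x∈C a (Reach-closed closed r (closed x∈C a (Reach-source r)))

  component : Subset (n R) → V → Subset (n R)
  component S u = tabulate (isYes ∘ Reach? S u)

  ∈-component : ∀ {S u x} → Reach R S u x → x ∈ component S u
  ∈-component {S} {u} {x} r =
    lookup⇒[]= x (component S u) (trans (lookup∘tabulate _ x) (Equivalence.to T-≡ (fromWitness r)))

  ∈-component⁻ : ∀ {S u x} → x ∈ component S u → Reach R S u x
  ∈-component⁻ {S} {u} {x} x∈ =
    toWitness (Equivalence.from T-≡ (trans (sym (lookup∘tabulate _ x)) ([]=⇒lookup x∈)))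

  component-⊆ : ∀ {S u} → component S u ⊆ S
  component-⊆ = Reach-target ∘ ∈-component⁻

  component-closed : ∀ {S u} → ClosedIn (component S u) S
  component-closed x∈ a y∈S = ∈-component (Reach-snoc (∈-component⁻ x∈) a y∈S)

  component-connected : ∀ {S u} → IsConnected R (component S u)
  component-connected x y x∈ y∈ =
    Reach-closed component-closed (Reach-trans (Reach-sym (∈-component⁻ x∈)) (∈-component⁻ y∈)) x∈

  connected-⊆-component : ∀ {S E u} → E ⊆ S → IsConnected R E → u ∈ E → E ⊆ component S u
  connected-⊆-component E⊆S E-conn u∈E {x} x∈E = ∈-component (Reach-mono E⊆S (E-conn _ x u∈E x∈E))

  -- Any walk from outside D to C can be cut at its first vertex in C, and until then it
  -- stays in Cᶜ, where closedness of D forbids stepping into D.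
  ∁-closed-connected : ∀ {C D c} → IsConnected R ⊤ → IsConnected R C → c ∈ C →
    D ⊆ ∁ C → ClosedIn D (∁ C) → IsConnected R (∁ D)
  ∁-closed-connected {C} {D} {c} G-conn C-conn c∈C D⊆∁C D-closed x y x∉D y∉D =
    Reach-trans (walk-to-C (G-conn x c ∈⊤ ∈⊤) (x∈∁p⇒x∉p x∉D))
                (Reach-sym (walk-to-C (G-conn y c ∈⊤ ∈⊤) (x∈∁p⇒x∉p y∉D)))
    where
    walk-to-C : ∀ {z} → Reach R ⊤ z c → z ∉ D → Reach R (∁ D) z c
    walk-to-C (here _) z∉D = here (x∉p⇒x∈∁p z∉D)
    walk-to-C {z} (step {v = z′} _ a r) z∉D with z ∈? C | z′ ∈? D
    ... | yes z∈C | _      = Reach-mono (⊆∁⇒⊆∁ D⊆∁C) (C-conn z c z∈C c∈C)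
    ... | no z∉C  | yes z′∈D = contradiction (D-closed z′∈D (Adj-sym a) (x∉p⇒x∈∁p z∉C)) z∉D
    ... | no _    | no z′∉D  = step (x∉p⇒x∈∁p z∉D) a (walk-to-C r z′∉D)

Crosses : ∀ {m} → Subset m → Fin m × Fin m → Set
Crosses A (a , b) = (a ∈ A × b ∉ A) ⊎ (a ∉ A × b ∈ A)

lookup≡false⇒∉ : ∀ {m} {A : Subset m} {x} → lookup A x ≡ false → x ∉ A
lookup≡false⇒∉ A[x]≡false x∈A with trans (sym ([]=⇒lookup x∈A)) A[x]≡false
... | ()

∉⇒lookup≡false : ∀ {m} {A : Subset m} {x} → x ∉ A → lookup A x ≡ false
∉⇒lookup≡false {A = A} {x} x∉A with lookup A x in A[x]
... | true  = contradiction (lookup⇒[]= x A A[x]) x∉A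
... | false = refl

crossesᵇ⇒Crosses : ∀ {m} (A : Subset m) a b → T (lookup A a xor lookup A b) → Crosses A (a , b)
crossesᵇ⇒Crosses A a b _ with lookup A a in A[a] | lookup A b in A[b]
... | true  | false = inj₁ (lookup⇒[]= a A A[a] , lookup≡false⇒∉ A[b])
... | false | true  = inj₂ (lookup≡false⇒∉ A[a] , lookup⇒[]= b A A[b])

Crosses⇒crossesᵇ : ∀ {m} (A : Subset m) a b → Crosses A (a , b) → T (lookup A a xor lookup A b)
Crosses⇒crossesᵇ A a b (inj₁ (a∈ , b∉)) rewrite []=⇒lookup a∈ | ∉⇒lookup≡false b∉ = _
Crosses⇒crossesᵇ A a b (inj₂ (a∉ , b∈)) rewrite ∉⇒lookup≡false a∉ | []=⇒lookup b∈ = _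

module _ (G : Graph) where

  private
    R = raw G

  cutSize-mono : ∀ {A B} → (∀ {e} → e ∈ₗ edges R → Crosses A e → Crosses B e) →
    cutSize G A ≤ cutSize G B
  cutSize-mono {A} {B} A⇒B = length-filter-mono _ _ (edges R) crossesᵇ-mono
    where
    crossesᵇ-mono : ∀ {e} → e ∈ₗ edges R →
      T (lookup A (proj₁ e) xor lookup A (proj₂ e)) → T (lookup B (proj₁ e) xor lookup B (proj₂ e))
    crossesᵇ-mono {a , b} e∈ = Crosses⇒crossesᵇ B a b ∘ A⇒B e∈ ∘ crossesᵇ⇒Crosses A a b

  cutSize-∁ : ∀ A → cutSize G (∁ A) ≡ cutSize G A
  cutSize-∁ A = cong length (filter-≐ _ _ (subst T (xor-∁ _) , subst T (sym (xor-∁ _))) (edges R))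
    where
    xor-∁ : ∀ e → lookup (∁ A) (proj₁ e) xor lookup (∁ A) (proj₂ e)
                 ≡ lookup A (proj₁ e) xor lookup A (proj₂ e)
    xor-∁ (a , b) = trans (cong₂ _xor_ (lookup-map a not A) (lookup-map b not A))
                          (xor-annihilates-not (lookup A a) (lookup A b))

  cutSize-closed : ∀ {C S} → C ⊆ S → ClosedIn C S → cutSize G C ≤ cutSize G S
  cutSize-closed {C} {S} C⊆S C-closed = cutSize-mono {C} {S} λ where
    e∈ (inj₁ (a∈C , b∉C)) → inj₁ (C⊆S a∈C , b∉C ∘ C-closed a∈C (inj₁ e∈))
    e∈ (inj₂ (a∉C , b∈C)) → inj₂ (a∉C ∘ C-closed b∈C (inj₂ e∈) , C⊆S b∈C)

  cutSize-component : ∀ S u → cutSize G (component S u) ≤ cutSize G S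
  cutSize-component S u = cutSize-closed (component-⊆ {S = S} {u}) (component-closed {S = S} {u})

module _ {G : Graph} (𝒮 : Scramble G) where

  private
    R = raw G

  ContainsEgg-mono : ∀ {A B} → A ⊆ B → ContainsEgg 𝒮 A → ContainsEgg 𝒮 B
  ContainsEgg-mono A⊆B (E , E∈ , E⊆A) = E , E∈ , λ x → A⊆B ∘ E⊆A x

  ContainsEgg⇒Nonempty : ∀ {A} → ContainsEgg 𝒮 A → Nonempty A
  ContainsEgg⇒Nonempty (E , E∈ , E⊆A) with All.lookup (eggsNonempty 𝒮) E∈
  ... | x , x∈E = x , E⊆A x x∈E

  ContainsEgg-component : ∀ {S} → ContainsEgg 𝒮 S → ∃ λ u → ContainsEgg 𝒮 (component S u)
  ContainsEgg-component (E , E∈ , E⊆S) with All.lookup (eggsNonempty 𝒮) E∈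
  ... | u , u∈E = u , E , E∈ , λ x →
    connected-⊆-component (λ {y} → E⊆S y) (All.lookup (eggsConnected 𝒮) E∈) u∈E {x}

  connected-egg-cut-≤ : ∀ {A} → EggCut 𝒮 A →
    ∃ λ D → ConnectedEggCut G 𝒮 D × cutSize G D ≤ cutSize G A
  connected-egg-cut-≤ {A} (egg-in-A , egg-in-∁A) =
    D , ((egg-in-D , egg-in-∁D) , component-connected , ∁D-connected) , cut-D≤cut-A
    where
    u : Fin (n R)
    u = proj₁ (ContainsEgg-component egg-in-A)
    C : Subset (n R)
    C = component A u
    egg-in-C : ContainsEgg 𝒮 C
    egg-in-C = proj₂ (ContainsEgg-component egg-in-A)
    egg-in-∁C : ContainsEgg 𝒮 (∁ C)
    egg-in-∁C = ContainsEgg-mono (p⊆q⇒∁p⊇∁q (component-⊆ {S = A})) egg-in-∁A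
    w : Fin (n R)
    w = proj₁ (ContainsEgg-component egg-in-∁C)
    D : Subset (n R)
    D = component (∁ C) w
    egg-in-D : ContainsEgg 𝒮 D
    egg-in-D = proj₂ (ContainsEgg-component egg-in-∁C)
    egg-in-∁D : ContainsEgg 𝒮 (∁ D)
    egg-in-∁D = ContainsEgg-mono (⊆∁⇒⊆∁ (component-⊆ {S = ∁ C})) egg-in-C
    ∁D-connected : IsConnected R (∁ D)
    ∁D-connected = ∁-closed-connected (connected G) component-connected
      (proj₂ (ContainsEgg⇒Nonempty egg-in-C)) (component-⊆ {S = ∁ C}) component-closed
    cut-D≤cut-A : cutSize G D ≤ cutSize G A
    cut-D≤cut-A = begin
      cutSize G D     ≤⟨ cutSize-component G (∁ C) w ⟩
      cutSize G (∁ C) ≡⟨ cutSize-∁ G C ⟩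
      cutSize G C     ≤⟨ cutSize-component G A u ⟩
      cutSize G A     ∎
      where open ≤-Reasoning

lemma2p4 : (G : Graph) (𝒮 : Scramble G) (v : ℕ∞) →
    EggCutNumber G 𝒮 v →
    IsMinOver (ConnectedEggCut G 𝒮) (cutSize G) v
lemma2p4 G 𝒮 nothing no-egg-cut A = no-egg-cut A ∘ proj₁
lemma2p4 G 𝒮 (just k) ((A , A-cut , cut-A≡k) , k-min) with connected-egg-cut-≤ 𝒮 A-cut
... | D , D-cut , cut-D≤cut-A =
  (D , D-cut , ≤-antisym (≤-trans cut-D≤cut-A (≤-reflexive cut-A≡k)) (k-min D (proj₁ D-cut))) ,
  λ B → k-min B ∘ proj₁
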